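{- Let $R$ be a finite commutative chain ring, let $k^*\ge1$ and $n\ge k^*$, and let $H=[B\mid I_{k^*}]\in R^{k^*\times n}$. Then every modular independent set of columns of $H$ is contained in a modular independent set of columns of cardinality $k^*$. In particular, every independent set of $M[H]$ is contained in some basis of $M[H]$.
   Context: $R$ is local with maximal ideal $\mathfrak{m}$. Vectors $v_1,\dots,v_\ell$ are modular independent if $\sum\alpha_iv_i=0$ implies all $\alpha_i\in\mathfrak{m}$. $M[H]$ is the independence system on the column index set $\{1,\dots,n\}$ whose independent sets are the sets of columns that are modular independent. A basis of an independence system $M$ on $E$ is an independent set $B$ with $|B|=r_M(E)$, where $r_M(X)=\max\{|I|:I\subseteq X\text{ independent}\}$. -}

module Defs where

open import Level using (Level; _⊔_; suc)
open import Algebra.Bundles using (CommutativeRing)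
open import Data.Nat as ℕ using (ℕ)
open import Data.Fin as Fin using (Fin; splitAt)
open import Data.Fin.Subset using (Subset; _∈_; _⊆_; ∣_∣)
open import Data.Fin.Properties using () renaming (_≟_ to _≟ᶠ_)
open import Data.Vec using (lookup)
open import Data.Bool using (Bool; true; false; if_then_else_)
open import Data.Sum using (_⊎_; inj₁; inj₂)
open import Data.Product using (Σ; ∃; _×_; _,_)
open import Relation.Nullary using (¬_; yes; no)
open import Relation.Unary using (Pred)
import Algebra.Definitions.RawMonoid as RawMonoidDefs

module _ {c ℓ : Level} (R : CommutativeRing c ℓ) where
  open CommutativeRing R

  ∑ : ∀ {n} → (Fin n → Carrier) → Carrier
  ∑ = RawMonoidDefs.sum +-rawMonoid

  IsFiniteRing : Set (c ⊔ ℓ)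
  IsFiniteRing = ∃ λ (m : ℕ) → Σ (Fin m → Carrier) λ f → ∀ x → ∃ λ i → f i ≈ x

  record IsIdeal (I : Pred Carrier (c ⊔ ℓ)) : Set (c ⊔ ℓ) where
    field
      resp  : ∀ {x y} → x ≈ y → I x → I y
      zero∈ : I 0#
      +-closed : ∀ {x y} → I x → I y → I (x + y)
      *-closed : ∀ r {x} → I x → I (r * x)

  _⊆ᵢ_ : Pred Carrier (c ⊔ ℓ) → Pred Carrier (c ⊔ ℓ) → Set (c ⊔ ℓ)
  I ⊆ᵢ J = ∀ {x} → I x → J x

  IsChainRing : Set (suc (c ⊔ ℓ))
  IsChainRing = ∀ I J → IsIdeal I → IsIdeal J → (I ⊆ᵢ J) ⊎ (J ⊆ᵢ I)

  record IsMaximalIdeal (𝔪 : Pred Carrier (c ⊔ ℓ)) : Set (suc (c ⊔ ℓ)) where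
    field
      isIdeal : IsIdeal 𝔪
      proper  : ¬ 𝔪 1#
      maximal : ∀ J → IsIdeal J → 𝔪 ⊆ᵢ J → (J ⊆ᵢ 𝔪) ⊎ J 1#

  -- H = [B | I_k] with B ∈ R^{k × m}, so H ∈ R^{k × (m + k)}; H i j = entry (row i, column j)
  stdH : ∀ {k m : ℕ} → (Fin k → Fin m → Carrier) → Fin k → Fin (m ℕ.+ k) → Carrier
  stdH {k} {m} B i j with splitAt m j
  ... | inj₁ a = B i a
  ... | inj₂ b with i ≟ᶠ b
  ...   | yes _ = 1#
  ...   | no  _ = 0#

  ModIndep : ∀ {k n : ℕ} → Pred Carrier (c ⊔ ℓ) → (Fin k → Fin n → Carrier) → Subset n → Set (c ⊔ ℓ)
  ModIndep 𝔪 H S =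
    ∀ (α : Fin _ → Carrier) →
      (∀ i → ∑ (λ j → if lookup S j then α j * H i j else 0#) ≈ 0#) →
      ∀ j → j ∈ S → 𝔪 (α j)

  IsBasis : ∀ {k n : ℕ} → Pred Carrier (c ⊔ ℓ) → (Fin k → Fin n → Carrier) → Subset n → Set (c ⊔ ℓ)
  IsBasis 𝔪 H Bs = ModIndep 𝔪 H Bs × (∀ I → ModIndep 𝔪 H I → ∣ I ∣ ℕ.≤ ∣ Bs ∣)

{-# OPTIONS --safe #-}
module Submission where

-- Call a set S of columns of a matrix independent in a set Q of rows when every relation
-- among the columns S that holds in the rows Q has all its coefficients in 𝔪.  Over a
-- chain ring divisibility is total, so some entry H r p of H on Q × S divides all the
-- others, and adding multiples of column p to the other columns of S clears row r on S
-- without affecting independence.  After that, S is independent in a row set Q′ ⊆ Q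
-- containing r exactly when S - p is independent in Q′ - r.  Induction on |Q| gives
-- |S| ≤ |Q|, and, when |S| < |Q|, a row i of Q whose removal keeps S independent.  The
-- unit column e_i of H = [B | I] can then be adjoined to S, so S grows to an independent
-- set of size k, which is a basis because no independent set is larger.

open import Defs
open import Level using (Level; _⊔_)
open import Algebra.Bundles using (CommutativeRing)
open import Data.Bool using (true; false; if_then_else_)
open import Data.Empty using (⊥-elim)
open import Data.Fin using (Fin; zero; suc; _↑ʳ_)
open import Data.Fin.Properties using (_≟_; suc-injective; splitAt-↑ʳ)
open import Data.Fin.Subset
  using (Subset; inside; outside; ⊤; _∈_; _∉_; _⊆_; _-_; _∪_; ⁅_⁆; ∣_∣; Nonempty; Empty)
open import Data.Fin.Subset.Properties
  using ( _∈?_; ∈⊤; x∈⁅x⁆; x∈⁅y⁆⇒x≡y; x∈p∪q⁺; x∈p∪q⁻; x∈p∧x≢y⇒x∈p-y; ∪-identityʳ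
        ; p⊆p∪q; p─q⊆p; p─x─y≡p─y─x; ⊆-refl; ⊆-trans; nonempty?; Empty-unique
        ; ∣⊥∣≡0; ∣⊤∣≡n; p⊆q⇒∣p∣≤∣q∣; p⊂q⇒∣p∣<∣q∣; x∈p⇒∣p-x∣<∣p∣)
open import Data.Nat as ℕ using (ℕ; _≤_; _<_; z≤n; s≤s; s≤s⁻¹)
open import Data.Nat.Induction using (<-wellFounded)
open import Data.Nat.Properties
  using (≤-refl; ≤-trans; ≤-reflexive; ≤-antisym; n≤1+n; n≮0; m≤n+m; +-suc; m∸n+n≡m)
open import Data.Product using (Σ; ∃; _×_; _,_; proj₁; proj₂)
open import Data.Sum using (inj₁; inj₂)
open import Data.Vec using (_∷_; here; there; lookup)
open import Data.Vec.Functional using (Vector)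
open import Data.Vec.Properties using ([]=⇒lookup; lookup⇒[]=)
open import Function using (_∘_; case_of_)
open import Induction.WellFounded using (Acc; acc)
open import Relation.Binary using (Rel; Reflexive; Transitive; Total)
open import Relation.Binary.PropositionalEquality as ≡ using (_≡_; _≢_)
import Relation.Binary.Reasoning.Setoid as ≈-Reasoning
open import Relation.Nullary using (¬_; does; yes; no)
open import Relation.Nullary.Decidable using (dec-true; dec-false)
open import Relation.Unary using (Pred)

private variable k n : ℕ

x∉p-x : ∀ x (p : Subset n) → x ∉ p - x
x∉p-x zero    (s ∷ p) ()
x∉p-x (suc x) (s ∷ p) (there x∈p-x) = x∉p-x x p x∈p-x

x∈p-y⇒x≢y : ∀ {x y} {p : Subset n} → x ∈ p - y → x ≢ y
x∈p-y⇒x≢y {p = p} x∈p-x ≡.refl = x∉p-x _ p x∈p-x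

∣p∪⁅x⁆∣≤1+∣p∣ : ∀ (p : Subset n) x → ∣ p ∪ ⁅ x ⁆ ∣ ≤ ℕ.suc ∣ p ∣
∣p∪⁅x⁆∣≤1+∣p∣ (inside  ∷ p) zero    rewrite ∪-identityʳ p = n≤1+n _
∣p∪⁅x⁆∣≤1+∣p∣ (outside ∷ p) zero    rewrite ∪-identityʳ p = ≤-refl
∣p∪⁅x⁆∣≤1+∣p∣ (inside  ∷ p) (suc x) = s≤s (∣p∪⁅x⁆∣≤1+∣p∣ p x)
∣p∪⁅x⁆∣≤1+∣p∣ (outside ∷ p) (suc x) = ∣p∪⁅x⁆∣≤1+∣p∣ p x

x∉p⇒∣p∪⁅x⁆∣≡1+∣p∣ : ∀ {p : Subset n} {x} → x ∉ p → ∣ p ∪ ⁅ x ⁆ ∣ ≡ ℕ.suc ∣ p ∣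
x∉p⇒∣p∪⁅x⁆∣≡1+∣p∣ {p = p} {x} x∉p = ≤-antisym (∣p∪⁅x⁆∣≤1+∣p∣ p x)
  (p⊂q⇒∣p∣<∣q∣ (p⊆p∪q ⁅ x ⁆ , x , x∈p∪q⁺ (inj₂ (x∈⁅x⁆ x)) , x∉p))

p⊆[p-x]∪⁅x⁆ : ∀ {p : Subset n} x → p ⊆ (p - x) ∪ ⁅ x ⁆
p⊆[p-x]∪⁅x⁆ x {y} y∈p with y ≟ x
... | yes ≡.refl = x∈p∪q⁺ (inj₂ (x∈⁅x⁆ x))
... | no  y≢x    = x∈p∪q⁺ (inj₁ (x∈p∧x≢y⇒x∈p-y y∈p y≢x))

∣p∣≤1+∣p-x∣ : ∀ (p : Subset n) x → ∣ p ∣ ≤ ℕ.suc ∣ p - x ∣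
∣p∣≤1+∣p-x∣ p x = ≤-trans (p⊆q⇒∣p∣≤∣q∣ (p⊆[p-x]∪⁅x⁆ {p = p} x)) (∣p∪⁅x⁆∣≤1+∣p∣ (p - x) x)

∣p-x∣≤∣q-y∣⇒∣p∣≤∣q∣ : ∀ (p : Subset n) x {q : Subset k} {y} → y ∈ q →
                      ∣ p - x ∣ ≤ ∣ q - y ∣ → ∣ p ∣ ≤ ∣ q ∣
∣p-x∣≤∣q-y∣⇒∣p∣≤∣q∣ p x y∈q ∣p-x∣≤∣q-y∣ =
  ≤-trans (∣p∣≤1+∣p-x∣ p x) (≤-trans (s≤s ∣p-x∣≤∣q-y∣) (x∈p⇒∣p-x∣<∣p∣ y∈q))

∣p∣<∣q∣⇒∣p-x∣<∣q-y∣ : ∀ {p : Subset n} {x} (q : Subset k) y → x ∈ p →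
                      ∣ p ∣ < ∣ q ∣ → ∣ p - x ∣ < ∣ q - y ∣
∣p∣<∣q∣⇒∣p-x∣<∣q-y∣ q y x∈p ∣p∣<∣q∣ =
  s≤s⁻¹ (≤-trans (s≤s (x∈p⇒∣p-x∣<∣p∣ x∈p)) (≤-trans ∣p∣<∣q∣ (∣p∣≤1+∣p-x∣ q y)))

Empty⇒∣p∣≡0 : {p : Subset n} → Empty p → ∣ p ∣ ≡ 0
Empty⇒∣p∣≡0 {n} p-empty = ≡.trans (≡.cong ∣_∣ (Empty-unique p-empty)) (∣⊥∣≡0 n)

module _ {a ℓ} {A : Set a} {_≲_ : Rel A ℓ}
         (≲-refl : Reflexive _≲_) (≲-trans : Transitive _≲_) (≲-total : Total _≲_) where

  argmin : (f : Fin n → A) (S : Subset n) → Nonempty S →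
           ∃ λ p → p ∈ S × (∀ {j} → j ∈ S → f p ≲ f j)
  argmin f (s ∷ S) S-nonempty with nonempty? S
  argmin f (inside ∷ S) _ | no S-empty =
    zero , here , λ { here → ≲-refl ; (there j∈S) → ⊥-elim (S-empty (_ , j∈S)) }
  argmin f (outside ∷ S) (suc j , there j∈S) | no S-empty = ⊥-elim (S-empty (j , j∈S))
  ... | yes S-nonempty with argmin (f ∘ suc) S S-nonempty
  argmin f (outside ∷ S) _ | yes _ | p , p∈S , p-min =
    suc p , there p∈S , λ { (there j∈S) → p-min j∈S }
  argmin f (inside ∷ S) _ | yes _ | p , p∈S , p-min with ≲-total (f zero) (f (suc p))
  ... | inj₁ f₀≲fₚ = zero , here , λ { here → ≲-refl ; (there j∈S) → ≲-trans f₀≲fₚ (p-min j∈S) }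
  ... | inj₂ fₚ≲f₀ = suc p , there p∈S , λ { here → fₚ≲f₀ ; (there j∈S) → p-min j∈S }

module LinearCombination {c ℓ} (R : CommutativeRing c ℓ) where

  open CommutativeRing R hiding (zero; _-_)
  open import Algebra.Properties.Semiring.Sum semiring
    using (sum; sum-cong-≋; sum-replicate-zero; ∑-distrib-+; *-distribʳ-sum)
  open import Relation.Binary.Reasoning.Setoid setoid

  Matrix : ℕ → ℕ → Set c
  Matrix k n = Fin k → Vector Carrier n

  infix 7 _·_
  _·_ : Vector Carrier n → Vector Carrier n → Carrier
  α · h = sum (λ j → α j * h j)

  single : Fin n → Carrier → Vector Carrier n
  single p x j = if does (j ≟ p) then x else 0#

  erase : Fin n → Vector Carrier n → Vector Carrier n
  erase p α j = if does (j ≟ p) then 0# else α j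

  SupportedOn : Subset n → Vector Carrier n → Set ℓ
  SupportedOn S α = ∀ {j} → j ∉ S → α j ≈ 0#

  addColumn : Matrix k n → Fin n → Vector Carrier n → Matrix k n
  addColumn H p c i j = H i j + c j * H i p

  private variable
    p j : Fin n
    x : Carrier
    α β g h : Vector Carrier n

  single-≡ : ∀ (p : Fin n) x → single p x p ≡ x
  single-≡ p x rewrite dec-true (p ≟ p) ≡.refl = ≡.refl

  single-≢ : j ≢ p → single p x j ≡ 0#
  single-≢ {j = j} {p} j≢p rewrite dec-false (j ≟ p) j≢p = ≡.refl

  erase-≡ : ∀ (p : Fin n) α → erase p α p ≡ 0#
  erase-≡ p α rewrite dec-true (p ≟ p) ≡.refl = ≡.refl

  erase-≢ : j ≢ p → erase p α j ≡ α j
  erase-≢ {j = j} {p} j≢p rewrite dec-false (j ≟ p) j≢p = ≡.refl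

  sum-≈0 : {f : Vector Carrier n} → (∀ j → f j ≈ 0#) → sum f ≈ 0#
  sum-≈0 {n} f≈0 = trans (sum-cong-≋ f≈0) (sum-replicate-zero n)

  sum-single : {f : Vector Carrier n} (p : Fin n) → (∀ {j} → j ≢ p → f j ≈ 0#) → sum f ≈ f p
  sum-single zero    f≈0 = trans (+-congˡ (sum-≈0 (λ j → f≈0 {suc j} λ ()))) (+-identityʳ _)
  sum-single (suc p) f≈0 = trans (+-congʳ (f≈0 {zero} λ ())) (trans (+-identityˡ _)
    (sum-single p (λ j≢p → f≈0 (j≢p ∘ suc-injective))))

  ·-cong : (∀ j → α j ≈ β j) → (∀ j → g j ≈ h j) → α · g ≈ β · h
  ·-cong {n} α≈β g≈h = sum-cong-≋ {n} (λ j → *-cong (α≈β j) (g≈h j))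

  ·-single : ∀ (p : Fin n) x h → single p x · h ≈ x * h p
  ·-single p x h = begin
    single p x · h      ≈⟨ sum-single p (λ j≢p → trans (*-congʳ (reflexive (single-≢ j≢p))) (zeroˡ _)) ⟩
    single p x p * h p  ≡⟨ ≡.cong (_* h p) (single-≡ p x) ⟩
    x * h p             ∎

  ·-distribʳ : ∀ (α β h : Vector Carrier n) → (λ j → α j + β j) · h ≈ α · h + β · h
  ·-distribʳ {n} α β h = trans (sum-cong-≋ {n} (λ j → distribʳ (h j) (α j) (β j)))
                               (∑-distrib-+ (λ j → α j * h j) (λ j → β j * h j))

  ·-addColumn : ∀ (α g c : Vector Carrier n) x → α · (λ j → g j + c j * x) ≈ α · g + (α · c) * x
  ·-addColumn {n} α g c x = begin
    α · (λ j → g j + c j * x)               ≈⟨ sum-cong-≋ {n} (λ j → distrib-assoc (α j) (g j) (c j)) ⟩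
    sum (λ j → α j * g j + α j * c j * x)   ≈⟨ ∑-distrib-+ (λ j → α j * g j) (λ j → α j * c j * x) ⟩
    α · g + sum (λ j → α j * c j * x)       ≈⟨ +-congˡ (sym (*-distribʳ-sum x (λ j → α j * c j))) ⟩
    α · g + (α · c) * x                     ∎
    where
    distrib-assoc : ∀ a b d → a * (b + d * x) ≈ a * b + a * d * x
    distrib-assoc a b d = trans (distribˡ a b (d * x)) (+-congˡ (sym (*-assoc a d x)))

  ·-erase : ∀ (p : Fin n) α h → α · h ≈ erase p α · h + α p * h p
  ·-erase p α h = begin
    α · h                                          ≈⟨ ·-cong α≈erase+single (λ _ → refl) ⟩
    (λ j → erase p α j + single p (α p) j) · h     ≈⟨ ·-distribʳ (erase p α) (single p (α p)) h ⟩
    erase p α · h + single p (α p) · h             ≈⟨ +-congˡ (·-single p (α p) h) ⟩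
    erase p α · h + α p * h p                      ∎
    where
    α≈erase+single : ∀ j → α j ≈ erase p α j + single p (α p) j
    α≈erase+single j with j ≟ p
    ... | yes ≡.refl = sym (+-identityˡ _)
    ... | no  _      = sym (+-identityʳ _)

  ·-erase-≈ : ∀ (p : Fin n) α h → α p * h p ≈ 0# → erase p α · h ≈ α · h
  ·-erase-≈ p α h αₚhₚ≈0 = sym (begin
    α · h                       ≈⟨ ·-erase p α h ⟩
    erase p α · h + α p * h p   ≈⟨ +-congˡ αₚhₚ≈0 ⟩
    erase p α · h + 0#          ≈⟨ +-identityʳ _ ⟩
    erase p α · h               ∎)

  ·-disjoint : ∀ {S : Subset n} → SupportedOn S α → (∀ {j} → j ∈ S → h j ≈ 0#) → α · h ≈ 0#
  ·-disjoint {α = α} {h} {S} α-supp h-vanishes = sum-≈0 αⱼhⱼ≈0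
    where
    αⱼhⱼ≈0 : ∀ j → α j * h j ≈ 0#
    αⱼhⱼ≈0 j with j ∈? S
    ... | yes j∈S = trans (*-congˡ (h-vanishes j∈S)) (zeroʳ _)
    ... | no  j∉S = trans (*-congʳ (α-supp j∉S)) (zeroˡ _)

  single-supported : ∀ {S : Subset n} {p} → p ∈ S → SupportedOn S (single p x)
  single-supported {x = x} {p = p} p∈S {j} j∉S =
    reflexive (single-≢ {j = j} {p} {x} λ { ≡.refl → j∉S p∈S })

  erase-supported : ∀ {S S′ : Subset n} {p} → (∀ {j} → j ∉ S′ → j ≢ p → j ∉ S) →
                    SupportedOn S α → SupportedOn S′ (erase p α)
  erase-supported {p = p} shrink α-supp {j} j∉S′ with j ≟ p
  ... | yes _   = refl
  ... | no  j≢p = α-supp (shrink j∉S′ j≢p)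

  addColumn-pivot : ∀ {H : Matrix k n} {p c} → c p ≈ 0# → ∀ i → addColumn H p c i p ≈ H i p
  addColumn-pivot {H = H} {p} cₚ≈0 i =
    trans (+-congˡ (trans (*-congʳ cₚ≈0) (zeroˡ _))) (+-identityʳ (H i p))

  addColumn-inverse : ∀ {H : Matrix k n} {p c} → c p ≈ 0# →
                      ∀ i j → addColumn (addColumn H p c) p (λ j → - c j) i j ≈ H i j
  addColumn-inverse {H = H} {p} {c} cₚ≈0 i j = begin
    (H i j + c j * H i p) + - c j * addColumn H p c i p
      ≈⟨ +-congˡ (*-congˡ (addColumn-pivot {H = H} {p} {c} cₚ≈0 i)) ⟩
    (H i j + c j * H i p) + - c j * H i p  ≈⟨ +-assoc _ _ _ ⟩
    H i j + (c j * H i p + - c j * H i p)  ≈⟨ +-congˡ (distribʳ (H i p) (c j) (- c j)) ⟨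
    H i j + (c j + - c j) * H i p          ≈⟨ +-congˡ (trans (*-congʳ (-‿inverseʳ (c j))) (zeroˡ _)) ⟩
    H i j + 0#                             ≈⟨ +-identityʳ _ ⟩
    H i j                                  ∎

  restrict : Subset n → Vector Carrier n → Vector Carrier n
  restrict S α j = if lookup S j then α j else 0#

  restrict-supported : ∀ {S : Subset n} α → SupportedOn S (restrict S α)
  restrict-supported {S = S} α {j} j∉S with lookup S j in S[j]
  ... | true  = ⊥-elim (j∉S (lookup⇒[]= j S S[j]))
  ... | false = refl

  restrict-∈ : ∀ {S : Subset n} α → j ∈ S → restrict S α j ≡ α j
  restrict-∈ α j∈S rewrite []=⇒lookup j∈S = ≡.refl

  restrict-supported-≈ : ∀ {S : Subset n} → SupportedOn S α → ∀ j → restrict S α j ≈ α j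
  restrict-supported-≈ {S = S} α-supp j with lookup S j in S[j]
  ... | true  = refl
  ... | false = sym (α-supp λ j∈S → case ≡.trans (≡.sym ([]=⇒lookup j∈S)) S[j] of λ ())

  ·-restrict : ∀ (S : Subset n) α h →
               restrict S α · h ≈ ∑ R (λ j → if lookup S j then α j * h j else 0#)
  ·-restrict {n} S α h = sum-cong-≋ {n} λ j → masked (lookup S j)
    where
    masked : ∀ b {x y} → (if b then x else 0#) * y ≈ (if b then x * y else 0#)
    masked true  = refl
    masked false = zeroˡ _

module Divisibility {c ℓ} (R : CommutativeRing c ℓ) where

  open CommutativeRing R hiding (_-_)
  open LinearCombination R
  open import Algebra.Definitions.RawMagma *-rawMagma using (_∣_; _,_; module _∣ʳ_)
  open import Algebra.Properties.Semiring.Divisibility semiring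
    using (∣ʳ-refl; ∣ʳ-trans; ∣ʳ-respʳ-≈)
  open import Algebra.Properties.Ring ring using (-‿distribˡ-*)

  multiples-isIdeal : ∀ a → IsIdeal R (a ∣_)
  multiples-isIdeal a = record
    { resp     = ∣ʳ-respʳ-≈
    ; zero∈    = 0# , zeroˡ a
    ; +-closed = λ (q , qa≈x) (q′ , q′a≈y) → q + q′ , trans (distribʳ a q q′) (+-cong qa≈x q′a≈y)
    ; *-closed = λ r (q , qa≈x) → r * q , trans (*-assoc r q a) (*-congˡ qa≈x)
    }

  ∣-total : IsChainRing R → Total _∣_
  ∣-total chain a b with chain (a ∣_) (b ∣_) (multiples-isIdeal a) (multiples-isIdeal b)
  ... | inj₁ a∣⊆b∣ = inj₂ (a∣⊆b∣ ∣ʳ-refl)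
  ... | inj₂ b∣⊆a∣ = inj₁ (b∣⊆a∣ ∣ʳ-refl)

  minimalEntry : IsChainRing R → (H : Matrix k n) {Q : Subset k} {S : Subset n} →
                 Nonempty Q → Nonempty S →
                 ∃ λ r → ∃ λ p → r ∈ Q × p ∈ S × (∀ {i j} → i ∈ Q → j ∈ S → H r p ∣ H i j)
  minimalEntry chain H {Q} {S} Q-nonempty S-nonempty =
    let r , r∈Q , r-min = argmin∣ (λ i → H i (proj₁ (rowArgmin i))) Q Q-nonempty
        p , p∈S , _     = rowArgmin r
    in r , p , r∈Q , p∈S , λ i∈Q j∈S → ∣ʳ-trans (r-min i∈Q) (proj₂ (proj₂ (rowArgmin _)) j∈S)
    where
    argmin∣ = argmin ∣ʳ-refl ∣ʳ-trans (∣-total chain)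
    rowArgmin : ∀ i → ∃ λ j → j ∈ S × (∀ {j′} → j′ ∈ S → H i j ∣ H i j′)
    rowArgmin i = argmin∣ (H i) S S-nonempty

  clearRow : ∀ (H : Matrix k n) {r p S} → (∀ {j} → j ∈ S → H r p ∣ H r j) →
             ∃ λ c → c p ≈ 0# × (∀ {j} → j ∈ S - p → addColumn H p c r j ≈ 0#)
  clearRow H {r} {p} {S} Hᵣₚ∣ =
    erase p (-_ ∘ quotient) , reflexive (erase-≡ p (-_ ∘ quotient)) , row-r
    where
    quotient : Vector Carrier _
    quotient j with j ∈? S
    ... | yes j∈S = _∣ʳ_.quotient (Hᵣₚ∣ j∈S)
    ... | no  _   = 0#

    quotient-spec : ∀ {j} → j ∈ S → quotient j * H r p ≈ H r j
    quotient-spec {j} j∈S with j ∈? S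
    ... | yes j∈S′ = _∣ʳ_.equality (Hᵣₚ∣ j∈S′)
    ... | no  j∉S  = ⊥-elim (j∉S j∈S)

    row-r : ∀ {j} → j ∈ S - p → H r j + erase p (-_ ∘ quotient) j * H r p ≈ 0#
    row-r {j} j∈S-p = begin
      H r j + erase p (-_ ∘ quotient) j * H r p
        ≡⟨ ≡.cong (λ x → H r j + x * H r p) (erase-≢ {α = -_ ∘ quotient} (x∈p-y⇒x≢y j∈S-p)) ⟩
      H r j + - quotient j * H r p    ≈⟨ +-congˡ (-‿distribˡ-* _ _) ⟨
      H r j + - (quotient j * H r p)  ≈⟨ +-congˡ (-‿cong (quotient-spec (p─q⊆p S ⁅ p ⁆ j∈S-p))) ⟩
      H r j + - H r j                 ≈⟨ -‿inverseʳ _ ⟩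
      0#                              ∎
      where open ≈-Reasoning setoid

module Independence {c ℓ} (R : CommutativeRing c ℓ)
  {𝔪 : Pred (CommutativeRing.Carrier R) (c ⊔ ℓ)} (𝔪-ideal : IsIdeal R 𝔪) where

  open CommutativeRing R hiding (zero; _-_)
  open LinearCombination R
  open IsIdeal 𝔪-ideal
  open import Algebra.Properties.Ring ring using (-1*x≈-x)
  open import Relation.Binary.Reasoning.Setoid setoid
  open import Algebra.Definitions.RawMagma *-rawMagma using (_∣_; module _∣ʳ_)
  open import Algebra.Properties.CommutativeSemigroup *-commutativeSemigroup using (x∙yz≈y∙xz)

  private variable
    x y : Carrier
    α h : Vector Carrier n
    H G : Matrix k n
    Q : Subset k
    S S′ : Subset n
    p : Fin n

  𝔪-≈0 : x ≈ 0# → 𝔪 x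
  𝔪-≈0 x≈0 = resp (sym x≈0) zero∈

  𝔪-*ʳ : ∀ y → 𝔪 x → 𝔪 (x * y)
  𝔪-*ʳ y x∈𝔪 = resp (*-comm y _) (*-closed y x∈𝔪)

  𝔪-cancelˡ : 𝔪 x → 𝔪 (x + y) → 𝔪 y
  𝔪-cancelˡ {x} {y} x∈𝔪 x+y∈𝔪 = resp -x+[x+y]≈y (+-closed (*-closed (- 1#) x∈𝔪) x+y∈𝔪)
    where
    -x+[x+y]≈y : - 1# * x + (x + y) ≈ y
    -x+[x+y]≈y = begin
      - 1# * x + (x + y) ≈⟨ +-congʳ (-1*x≈-x x) ⟩
      - x + (x + y)      ≈⟨ +-assoc (- x) x y ⟨
      (- x + x) + y      ≈⟨ +-congʳ (-‿inverseˡ x) ⟩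
      0# + y             ≈⟨ +-identityˡ y ⟩
      y                  ∎

  𝔪-cancelʳ : 𝔪 y → 𝔪 (x + y) → 𝔪 x
  𝔪-cancelʳ y∈𝔪 x+y∈𝔪 = 𝔪-cancelˡ y∈𝔪 (resp (+-comm _ _) x+y∈𝔪)

  𝔪-· : (∀ j → 𝔪 (α j)) → 𝔪 (α · h)
  𝔪-· {ℕ.zero}  _    = zero∈
  𝔪-· {ℕ.suc n} α∈𝔪 = +-closed (𝔪-*ʳ _ (α∈𝔪 zero)) (𝔪-· (α∈𝔪 ∘ suc))

  𝔪-erase : ∀ p → 𝔪 (α p) → (∀ j → 𝔪 (erase p α j)) → ∀ j → 𝔪 (α j)
  𝔪-erase p αₚ∈𝔪 erase∈𝔪 j with j ≟ p | erase∈𝔪 j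
  ... | yes ≡.refl | _    = αₚ∈𝔪
  ... | no  _      | αⱼ∈𝔪 = αⱼ∈𝔪

  -- Coefficient vectors are required to vanish off S instead of being masked by S as in ModIndep.
  IndepOn : Matrix k n → Subset k → Subset n → Set (c ⊔ ℓ)
  IndepOn H Q S = ∀ α → SupportedOn S α → (∀ {i} → i ∈ Q → α · H i ≈ 0#) → ∀ j → 𝔪 (α j)

  IndepOn-⊆ : S′ ⊆ S → IndepOn H Q S → IndepOn H Q S′
  IndepOn-⊆ S′⊆S ind α α-supp = ind α (α-supp ∘ (_∘ S′⊆S))

  IndepOn-Empty : Empty S → IndepOn H Q S
  IndepOn-Empty S-empty α α-supp _ j = 𝔪-≈0 (α-supp (λ j∈S → S-empty (j , j∈S)))

  IndepOn-cong : (∀ i j → H i j ≈ G i j) → IndepOn H Q S → IndepOn G Q S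
  IndepOn-cong H≈G ind α α-supp α-rel =
    ind α α-supp (λ i∈Q → trans (·-cong (λ _ → refl) (H≈G _)) (α-rel i∈Q))

  IndepOn-dropZeroRow : ∀ {r} → (∀ {j} → j ∈ S → H r j ≈ 0#) → IndepOn H Q S → IndepOn H (Q - r) S
  IndepOn-dropZeroRow {S = S} {H = H} {Q = Q} {r = r} row-r ind α α-supp α-rel = ind α α-supp rel
    where
    rel : ∀ {i} → i ∈ Q → α · H i ≈ 0#
    rel {i} i∈Q with i ≟ r
    ... | yes ≡.refl = ·-disjoint α-supp row-r
    ... | no  i≢r    = α-rel (x∈p∧x≢y⇒x∈p-y i∈Q i≢r)

  -- β · (column j + c j · column p) ≈ (β + single p (β · c)) · column j: a relation of the
  -- new matrix gives a relation of H that agrees with it off p.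
  IndepOn-addColumn : ∀ {c} → p ∈ S → c p ≈ 0# → IndepOn H Q S → IndepOn (addColumn H p c) Q S
  IndepOn-addColumn {p = p} {S = S} {H = H} {Q = Q} {c = c} p∈S cₚ≈0 ind β β-supp β-rel =
    𝔪-erase p βₚ∈𝔪 erase∈𝔪
    where
    s = β · c
    γ : Vector Carrier _
    γ = λ j → β j + single p s j
    γ-supp : SupportedOn S γ
    γ-supp j∉S = trans (+-cong (β-supp j∉S) (single-supported p∈S j∉S)) (+-identityʳ 0#)
    γ-rel : ∀ {i} → i ∈ Q → γ · H i ≈ 0#
    γ-rel {i} i∈Q = begin
      γ · H i                    ≈⟨ ·-distribʳ β (single p s) (H i) ⟩
      β · H i + single p s · H i ≈⟨ +-congˡ (·-single p s (H i)) ⟩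
      β · H i + s * H i p        ≈⟨ ·-addColumn β (H i) c (H i p) ⟨
      β · addColumn H p c i      ≈⟨ β-rel i∈Q ⟩
      0#                         ∎
    γ∈𝔪 : ∀ j → 𝔪 (γ j)
    γ∈𝔪 = ind γ γ-supp γ-rel
    erase∈𝔪 : ∀ j → 𝔪 (erase p β j)
    erase∈𝔪 j with j ≟ p | γ∈𝔪 j
    ... | yes _ | _    = zero∈
    ... | no  _ | γⱼ∈𝔪 = resp (+-identityʳ _) γⱼ∈𝔪
    s∈𝔪 : 𝔪 s
    s∈𝔪 = resp (·-erase-≈ p β c (trans (*-congˡ cₚ≈0) (zeroʳ _))) (𝔪-· erase∈𝔪)
    βₚ∈𝔪 : 𝔪 (β p)
    βₚ∈𝔪 = 𝔪-cancelʳ s∈𝔪 (resp (+-congˡ (reflexive (single-≡ p s))) (γ∈𝔪 p))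

  -- A relation β in Q′ gives β p · G r p ≈ 0; as G r p divides column p on Q, single p (β p)
  -- is then a relation in Q, so β p ∈ 𝔪, and erase p β is a relation in Q′ - r.
  IndepOn-lift : ∀ {G : Matrix k n} {r Q Q′ S p} → p ∈ S →
                 (∀ {j} → j ∈ S - p → G r j ≈ 0#) → (∀ {i} → i ∈ Q → G r p ∣ G i p) →
                 IndepOn G Q S → Q′ ⊆ Q → r ∈ Q′ → IndepOn G (Q′ - r) (S - p) → IndepOn G Q′ S
  IndepOn-lift {G = G} {r} {Q} {Q′} {S} {p} p∈S row-r pivot∣ ind Q′⊆Q r∈Q′ ind′ β β-supp β-rel =
    𝔪-erase p βₚ∈𝔪 erase∈𝔪
    where
    erase-supp : SupportedOn (S - p) (erase p β)
    erase-supp = erase-supported (λ j∉S-p j≢p j∈S → j∉S-p (x∈p∧x≢y⇒x∈p-y j∈S j≢p)) β-supp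
    βₚGᵣₚ≈0 : β p * G r p ≈ 0#
    βₚGᵣₚ≈0 = begin
      β p * G r p                  ≈⟨ +-identityˡ _ ⟨
      0# + β p * G r p             ≈⟨ +-congʳ (·-disjoint erase-supp row-r) ⟨
      erase p β · G r + β p * G r p ≈⟨ ·-erase p β (G r) ⟨
      β · G r                      ≈⟨ β-rel r∈Q′ ⟩
      0#                           ∎
    βₚGᵢₚ≈0 : ∀ {i} → i ∈ Q → β p * G i p ≈ 0#
    βₚGᵢₚ≈0 {i} i∈Q = begin
      β p * G i p          ≈⟨ *-congˡ (_∣ʳ_.equality (pivot∣ i∈Q)) ⟨
      β p * (d * G r p)    ≈⟨ x∙yz≈y∙xz (β p) d (G r p) ⟩
      d * (β p * G r p)    ≈⟨ *-congˡ βₚGᵣₚ≈0 ⟩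
      d * 0#               ≈⟨ zeroʳ d ⟩
      0#                   ∎
      where d = _∣ʳ_.quotient (pivot∣ i∈Q)
    βₚ∈𝔪 : 𝔪 (β p)
    βₚ∈𝔪 = ≡.subst 𝔪 (single-≡ p (β p))
      (ind (single p (β p)) (single-supported p∈S)
           (λ i∈Q → trans (·-single p (β p) (G _)) (βₚGᵢₚ≈0 i∈Q)) p)
    erase∈𝔪 : ∀ j → 𝔪 (erase p β j)
    erase∈𝔪 = ind′ (erase p β) erase-supp λ i∈Q′-r →
      let i∈Q′ = p─q⊆p Q′ ⁅ r ⁆ i∈Q′-r in
      trans (·-erase-≈ p β (G _) (βₚGᵢₚ≈0 (Q′⊆Q i∈Q′))) (β-rel i∈Q′)

  IndepOn-∪-unitColumn : ∀ {H : Matrix k n} {Q S i c} → i ∈ Q → (∀ i′ → H i′ c ≈ single i 1# i′) →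
                         IndepOn H (Q - i) S → IndepOn H Q (S ∪ ⁅ c ⁆)
  IndepOn-∪-unitColumn {H = H} {Q} {S} {i} {c} i∈Q column-c ind α α-supp α-rel =
    𝔪-erase c αc∈𝔪 erase∈𝔪
    where
    erase-supp : SupportedOn S (erase c α)
    erase-supp = erase-supported (λ j∉S j≢c j∈S∪c → case x∈p∪q⁻ S ⁅ c ⁆ j∈S∪c of λ where
                                     (inj₁ j∈S) → j∉S j∈S
                                     (inj₂ j∈c) → j≢c (x∈⁅y⁆⇒x≡y c j∈c))
                                 α-supp
    erase∈𝔪 : ∀ j → 𝔪 (erase c α j)
    erase∈𝔪 = ind (erase c α) erase-supp λ {i′} i′∈Q-i →
      let Hᵢ′c≈0 = trans (column-c i′) (reflexive (single-≢ (x∈p-y⇒x≢y i′∈Q-i))) in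
      trans (·-erase-≈ c α (H i′) (trans (*-congˡ Hᵢ′c≈0) (zeroʳ _))) (α-rel (p─q⊆p Q ⁅ i ⁆ i′∈Q-i))
    αc∈𝔪 : 𝔪 (α c)
    αc∈𝔪 = resp αcHᵢc≈αc (𝔪-cancelˡ (𝔪-· erase∈𝔪) (resp (·-erase c α (H i)) (𝔪-≈0 (α-rel i∈Q))))
      where
      αcHᵢc≈αc : α c * H i c ≈ α c
      αcHᵢc≈αc = trans (*-congˡ (trans (column-c i) (reflexive (single-≡ i 1#)))) (*-identityʳ _)

  ModIndep⇒IndepOn : ∀ {H : Matrix k n} {S} → ModIndep R 𝔪 H S → IndepOn H ⊤ S
  ModIndep⇒IndepOn {H = H} {S} mi α α-supp α-rel j with j ∈? S
  ... | yes j∈S = mi α (λ i → trans (sym (·-restrict S α (H i))) (relation i)) j j∈S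
    where
    relation : ∀ i → restrict S α · H i ≈ 0#
    relation i = trans (·-cong (restrict-supported-≈ α-supp) (λ _ → refl)) (α-rel ∈⊤)
  ... | no  j∉S = 𝔪-≈0 (α-supp j∉S)

  IndepOn⇒ModIndep : ∀ {H : Matrix k n} {S} → IndepOn H ⊤ S → ModIndep R 𝔪 H S
  IndepOn⇒ModIndep {H = H} {S} ind α α-rel j j∈S = ≡.subst 𝔪 (restrict-∈ α j∈S)
    (ind (restrict S α) (restrict-supported α) (λ {i} _ → trans (·-restrict S α (H i)) (α-rel i)) j)

  module _ (1∉𝔪 : ¬ 𝔪 1#) where

    IndepOn-zeroColumn-∉ : ∀ {c} → (∀ {i} → i ∈ Q → H i c ≈ 0#) → IndepOn H Q S → c ∉ S
    IndepOn-zeroColumn-∉ {H = H} {c = c} column-c ind c∈S = 1∉𝔪 (≡.subst 𝔪 (single-≡ c 1#)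
      (ind (single c 1#) (single-supported c∈S)
           (λ i∈Q → trans (·-single c 1# (H _)) (trans (*-congˡ (column-c i∈Q)) (zeroʳ 1#))) c))

    IndepOn-Nonempty : IndepOn H Q S → Nonempty S → Nonempty Q
    IndepOn-Nonempty {Q = Q} ind (p , p∈S) with nonempty? Q
    ... | yes Q-nonempty = Q-nonempty
    ... | no  Q-empty    = ⊥-elim (IndepOn-zeroColumn-∉ (λ i∈Q → ⊥-elim (Q-empty (_ , i∈Q))) ind p∈S)

module Elimination {c ℓ} (R : CommutativeRing c ℓ) (chain : IsChainRing R)
  {𝔪 : Pred (CommutativeRing.Carrier R) (c ⊔ ℓ)} (𝔪-ideal : IsIdeal R 𝔪)
  (1∉𝔪 : ¬ 𝔪 (CommutativeRing.1# R)) where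

  open CommutativeRing R hiding (zero; _-_)
  open LinearCombination R
  open Independence R 𝔪-ideal
  open Divisibility R
  open import Algebra.Definitions.RawMagma *-rawMagma using (_∣_)
  open import Algebra.Properties.Semiring.Divisibility semiring using (∣ʳ-respˡ-≈; ∣ʳ-respʳ-≈)
  open import Algebra.Properties.Ring ring using (-0#≈0#)

  -- One step of Gaussian elimination: H′ is H with row r cleared on S - p by adding
  -- multiples of the pivot column p to the other columns.
  record Pivot (H : Matrix k n) (Q : Subset k) (S : Subset n) : Set (c ⊔ ℓ) where
    field
      r      : Fin k
      p      : Fin n
      r∈Q    : r ∈ Q
      p∈S    : p ∈ S
      H′     : Matrix k n
      reduce : IndepOn H′ (Q - r) (S - p)
      lift   : ∀ {Q′} → Q′ ⊆ Q → r ∈ Q′ → IndepOn H′ (Q′ - r) (S - p) → IndepOn H Q′ S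

  pivot : ∀ {H : Matrix k n} {Q S} → IndepOn H Q S → Nonempty S → Pivot H Q S
  pivot {H = H} {Q} {S} ind S-nonempty
    with minimalEntry chain H (IndepOn-Nonempty 1∉𝔪 ind S-nonempty) S-nonempty
  ... | r , p , r∈Q , p∈S , Hᵣₚ∣ with clearRow H (Hᵣₚ∣ r∈Q)
  ... | c , cₚ≈0 , row-r = record
    { r = r ; p = p ; r∈Q = r∈Q ; p∈S = p∈S ; H′ = H′ ; reduce = reduce ; lift = lift }
    where
    H′ = addColumn H p c

    pivot∣ : ∀ {i} → i ∈ Q → H′ r p ∣ H′ i p
    pivot∣ i∈Q = ∣ʳ-respˡ-≈ (sym (addColumn-pivot {H = H} {p} {c} cₚ≈0 _))
                   (∣ʳ-respʳ-≈ (sym (addColumn-pivot {H = H} {p} {c} cₚ≈0 _)) (Hᵣₚ∣ i∈Q p∈S))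

    ind′ : IndepOn H′ Q S
    ind′ = IndepOn-addColumn p∈S cₚ≈0 ind

    reduce : IndepOn H′ (Q - r) (S - p)
    reduce = IndepOn-dropZeroRow row-r (IndepOn-⊆ (p─q⊆p S ⁅ p ⁆) ind′)

    lift : ∀ {Q′} → Q′ ⊆ Q → r ∈ Q′ → IndepOn H′ (Q′ - r) (S - p) → IndepOn H Q′ S
    lift Q′⊆Q r∈Q′ ind″ = IndepOn-cong (addColumn-inverse {H = H} {p} {c} cₚ≈0)
      (IndepOn-addColumn p∈S (trans (-‿cong cₚ≈0) -0#≈0#)
        (IndepOn-lift p∈S row-r pivot∣ ind′ Q′⊆Q r∈Q′ ind″))

  IndepOn⇒∣S∣≤∣Q∣ : ∀ {H : Matrix k n} {Q S} → IndepOn H Q S → ∣ S ∣ ≤ ∣ Q ∣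
  IndepOn⇒∣S∣≤∣Q∣ {Q = Q} = go (<-wellFounded ∣ Q ∣)
    where
    go : ∀ {H : Matrix k n} {Q S} → Acc _<_ ∣ Q ∣ → IndepOn H Q S → ∣ S ∣ ≤ ∣ Q ∣
    go {S = S} (acc rec) ind with nonempty? S
    ... | no  S-empty    = ≤-trans (≤-reflexive (Empty⇒∣p∣≡0 S-empty)) z≤n
    ... | yes S-nonempty = ∣p-x∣≤∣q-y∣⇒∣p∣≤∣q∣ S p r∈Q (go (rec (x∈p⇒∣p-x∣<∣p∣ r∈Q)) reduce)
      where open Pivot (pivot ind S-nonempty)

  IndepOn-dropRow : ∀ {H : Matrix k n} {Q S} → IndepOn H Q S → ∣ S ∣ < ∣ Q ∣ →
                    ∃ λ i → i ∈ Q × IndepOn H (Q - i) S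
  IndepOn-dropRow {Q = Q} = go (<-wellFounded ∣ Q ∣)
    where
    go : ∀ {H : Matrix k n} {Q S} → Acc _<_ ∣ Q ∣ → IndepOn H Q S → ∣ S ∣ < ∣ Q ∣ →
         ∃ λ i → i ∈ Q × IndepOn H (Q - i) S
    go {Q = Q} {S} (acc rec) ind ∣S∣<∣Q∣ with nonempty? S | nonempty? Q
    ... | no S-empty | yes (i , i∈Q) = i , i∈Q , IndepOn-Empty S-empty
    ... | no _       | no  Q-empty   =
      ⊥-elim (n≮0 (≤-trans ∣S∣<∣Q∣ (≤-reflexive (Empty⇒∣p∣≡0 Q-empty))))
    ... | yes S-nonempty | _ =
      let i , i∈Q-r , ind″ = go (rec (x∈p⇒∣p-x∣<∣p∣ r∈Q)) reduce
                                (∣p∣<∣q∣⇒∣p-x∣<∣q-y∣ Q r p∈S ∣S∣<∣Q∣)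
          r∈Q-i = x∈p∧x≢y⇒x∈p-y r∈Q (x∈p-y⇒x≢y i∈Q-r ∘ ≡.sym)
      in i , p─q⊆p Q ⁅ r ⁆ i∈Q-r ,
         lift (p─q⊆p Q ⁅ i ⁆) r∈Q-i (≡.subst (λ X → IndepOn H′ X (S - p)) (p─x─y≡p─y─x Q r i) ind″)
      where open Pivot (pivot ind S-nonempty)

  IndepOn-extend : ∀ {H : Matrix k n} {Q S} (e : Fin k → Fin n) →
                   (∀ i i′ → H i′ (e i) ≈ single i 1# i′) →
                   IndepOn H Q S → ∃ λ T → S ⊆ T × ∣ T ∣ ≡ ∣ Q ∣ × IndepOn H Q T
  IndepOn-extend {H = H} {Q} {S} e e-unit ind =
    go (∣ Q ∣ ℕ.∸ ∣ S ∣) (m∸n+n≡m (IndepOn⇒∣S∣≤∣Q∣ ind)) ind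
    where
    go : ∀ d {S} → d ℕ.+ ∣ S ∣ ≡ ∣ Q ∣ → IndepOn H Q S →
         ∃ λ T → S ⊆ T × ∣ T ∣ ≡ ∣ Q ∣ × IndepOn H Q T
    go ℕ.zero    {S} ∣S∣≡∣Q∣ ind = S , ⊆-refl , ∣S∣≡∣Q∣ , ind
    go (ℕ.suc d) {S} 1+d+∣S∣≡∣Q∣ ind =
      let i , i∈Q , indᵢ = IndepOn-dropRow ind (≤-trans (s≤s (m≤n+m ∣ S ∣ d)) (≤-reflexive 1+d+∣S∣≡∣Q∣))
          eᵢ-zero : ∀ {i′} → i′ ∈ Q - i → H i′ (e i) ≈ 0#
          eᵢ-zero i′∈Q-i = trans (e-unit i _) (reflexive (single-≢ (x∈p-y⇒x≢y i′∈Q-i)))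
          eᵢ∉S = IndepOn-zeroColumn-∉ 1∉𝔪 eᵢ-zero indᵢ
          d+∣S∪eᵢ∣≡∣Q∣ = ≡.trans (≡.cong (d ℕ.+_) (x∉p⇒∣p∪⁅x⁆∣≡1+∣p∣ eᵢ∉S))
                                 (≡.trans (+-suc d ∣ S ∣) 1+d+∣S∣≡∣Q∣)
          T , S∪eᵢ⊆T , ∣T∣≡∣Q∣ , indT = go d d+∣S∪eᵢ∣≡∣Q∣ (IndepOn-∪-unitColumn i∈Q (e-unit i) indᵢ)
      in T , ⊆-trans (p⊆p∪q ⁅ e i ⁆) S∪eᵢ⊆T , ∣T∣≡∣Q∣ , indT

module _ {c ℓ} (R : CommutativeRing c ℓ) where

  open CommutativeRing R using (Carrier; _≈_; 1#; refl)
  open LinearCombination R using (single)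

  stdH-unitColumn : ∀ {k m} (B : Fin k → Fin m → Carrier) i i′ →
                    stdH R B i′ (m ↑ʳ i) ≈ single i 1# i′
  stdH-unitColumn {k} {m} B i i′ rewrite splitAt-↑ʳ m k i with i′ ≟ i
  ... | yes _ = refl
  ... | no  _ = refl

-- Imported only here, since above _+_ is the addition of a ring.
open import Data.Nat using (_+_)

lemma4p24 : ∀ {c ℓ : Level} (R : CommutativeRing c ℓ) →
    IsFiniteRing R → IsChainRing R →
    (𝔪 : Pred (CommutativeRing.Carrier R) _) → IsMaximalIdeal R 𝔪 →
    (k m : ℕ) → 1 ≤ k →
    (B : Fin k → Fin m → CommutativeRing.Carrier R) →
    ((S : Subset (m + k)) → ModIndep R 𝔪 (stdH R B) S →
      Σ (Subset (m + k)) λ T → S ⊆ T × ∣ T ∣ ≡ k × ModIndep R 𝔪 (stdH R B) T)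
    ×
    ((S : Subset (m + k)) → ModIndep R 𝔪 (stdH R B) S →
      Σ (Subset (m + k)) λ T → S ⊆ T × IsBasis R 𝔪 (stdH R B) T)
lemma4p24 R _ chain 𝔪 𝔪-maximal k m _ B = extendToSize-k , extendToBasis
  where
  open IsMaximalIdeal 𝔪-maximal using (isIdeal; proper)
  open Independence R isIdeal using (ModIndep⇒IndepOn; IndepOn⇒ModIndep)
  open Elimination R chain isIdeal proper using (IndepOn⇒∣S∣≤∣Q∣; IndepOn-extend)

  extendToSize-k : (S : Subset (m + k)) → ModIndep R 𝔪 (stdH R B) S →
    Σ (Subset (m + k)) λ T → S ⊆ T × ∣ T ∣ ≡ k × ModIndep R 𝔪 (stdH R B) T
  extendToSize-k S ind =
    let T , S⊆T , ∣T∣≡∣⊤∣ , indT = IndepOn-extend (m ↑ʳ_) (stdH-unitColumn R B) (ModIndep⇒IndepOn ind)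
    in T , S⊆T , ≡.trans ∣T∣≡∣⊤∣ (∣⊤∣≡n k) , IndepOn⇒ModIndep indT

  extendToBasis : (S : Subset (m + k)) → ModIndep R 𝔪 (stdH R B) S →
    Σ (Subset (m + k)) λ T → S ⊆ T × IsBasis R 𝔪 (stdH R B) T
  extendToBasis S ind =
    let T , S⊆T , ∣T∣≡k , indT = extendToSize-k S ind
    in T , S⊆T , indT , λ I indI → ≤-trans (IndepOn⇒∣S∣≤∣Q∣ (ModIndep⇒IndepOn indI))
                                           (≤-reflexive (≡.trans (∣⊤∣≡n k) (≡.sym ∣T∣≡k)))
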